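{- For $n\ge 2$, the line graph $L(K_n)$ of the complete graph $K_n$ satisfies $\mathrm{gp}^-(L(K_n))=\frac{n}{2}$ if $n$ is even and $\mathrm{gp}^-(L(K_n))=\frac{n+3}{2}$ if $n$ is odd.
   Context: A set $S$ of vertices of a connected graph $G$ is a general position set if no shortest path contains three or more vertices of $S$; it is maximal if not properly contained in another general position set; $\mathrm{gp}^-(G)$ is the number of vertices in a smallest maximal general position set. -}

module Defs where

open import Data.Nat using (ℕ; zero; suc; _≤_)
open import Data.Fin using (Fin)
import Data.Fin as F
open import Data.List using (List; []; _∷_; length)
open import Data.List.Membership.Propositional using (_∈_)
open import Data.List.Relation.Unary.Unique.Propositional using (Unique)
open import Data.Product using (Σ; ∃; ∃-syntax; _×_; _,_)
open import Data.Sum using (_⊎_)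
open import Relation.Nullary using (¬_)
open import Relation.Binary.PropositionalEquality using (_≡_; _≢_)

module GraphTheory {V : Set} (Adj : V → V → Set) where

  data Walk : V → V → ℕ → Set where
    [] : ∀ {u} → Walk u u 0
    _∷_ : ∀ {u w v k} → Adj u w → Walk w v k → Walk u v (suc k)

  verts : ∀ {u v k} → Walk u v k → List V
  verts {u} [] = u ∷ []
  verts {u} (_ ∷ p) = u ∷ verts p

  Shortest : ∀ {u v k} → Walk u v k → Set
  Shortest {u} {v} {k} _ = ∀ k' → Walk u v k' → k ≤ k'

  -- vertex sets are duplicate-free lists
  _⊆_ : List V → List V → Set
  S ⊆ T = ∀ x → x ∈ S → x ∈ T

  GeneralPosition : List V → Set
  GeneralPosition S =
    Unique S ×
    (∀ u v k (p : Walk u v k) → Shortest p →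
      ¬ (∃[ x ] ∃[ y ] ∃[ z ] (x ≢ y × x ≢ z × y ≢ z ×
           x ∈ S × y ∈ S × z ∈ S ×
           x ∈ verts p × y ∈ verts p × z ∈ verts p)))

  MaximalGP : List V → Set
  MaximalGP S = GeneralPosition S × (∀ T → GeneralPosition T → S ⊆ T → T ⊆ S)

  GpMinusIs : ℕ → Set
  GpMinusIs k = (∃[ S ] (MaximalGP S × length S ≡ k)) ×
                (∀ S → MaximalGP S → k ≤ length S)

-- Line graph of the complete graph K_n:
-- vertices are the edges {i,j} of K_n, encoded as (i , j) with i < j;
-- two vertices are adjacent iff they are distinct edges sharing an endpoint.
LKVertex : ℕ → Set
LKVertex n = Σ (Fin n × Fin n) (λ { (i , j) → i F.< j })

LKAdj : ∀ {n} → LKVertex n → LKVertex n → Set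
LKAdj e@((i , j) , _) f@((k , l) , _) =
  e ≢ f × (i ≡ k ⊎ i ≡ l ⊎ j ≡ k ⊎ j ≡ l)

gpMinusLKIs : ℕ → ℕ → Set
gpMinusLKIs n k = GraphTheory.GpMinusIs (LKAdj {n}) k

-- Vertices of L(K_n) are the edges of K_n, and L(K_n) has diameter at most 2, so a set S of edges is in
-- general position iff it contains no induced path x – y – z: the edges of S fall into clusters of pairwise
-- meeting edges (stars and triangles), and S is maximal iff every other edge is the middle of such a path.
-- Hence a perfect matching, or for odd n a triangle plus a perfect matching of the remaining points, is
-- maximal: every other edge joins two clusters.
-- The lower bounds count degrees, Σ deg = 2|S|. Two isolated points could be joined, so n ≤ 2|S| + 1.
-- For n = 2m + 1 and |S| ≤ m + 1 the surplus Σ (deg ∸ 1) is at most 2. Without isolated points, parity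
-- leaves one point c of degree 2 and all others of degree 1, and the edge joining the two neighbours of c
-- could be added. With an isolated point u, the edges at u force two adjacent points of degree ≥ 2, hence
-- a triangle of such points, whose surplus 3 is too large.
module Submission where

open import Defs
open import Data.Empty using (⊥; ⊥-elim)
open import Data.Fin as F using (Fin; zero; suc; _↑ˡ_; _↑ʳ_)
import Data.Fin.Properties as F
open import Data.List using (List; []; _∷_; length; map; _++_)
import Data.List.Properties as List
open import Data.List.Membership.Propositional using (_∈_; _∉_; _─_)
open import Data.List.Membership.Propositional.Properties using (∈-map⁺; ∈-map⁻; ∈-++⁺ˡ; ∈-++⁺ʳ; ∈-++⁻)
open import Data.List.Relation.Unary.All as All using (All; []; _∷_)
open import Data.List.Relation.Unary.All.Properties.Core using (¬Any⇒All¬)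
open import Data.List.Relation.Unary.AllPairs using ([]; _∷_)
open import Data.List.Relation.Unary.Any using (here; there)
open import Data.List.Relation.Unary.Unique.Propositional using (Unique)
import Data.List.Relation.Unary.Unique.Propositional.Properties as Unique
open import Data.Nat using (ℕ; zero; suc; _≤_; _<_; _+_; _*_; _∸_; z≤n; s≤s)
import Data.Nat.Properties as ℕ
open import Algebra.Properties.CommutativeMonoid.Sum ℕ.+-0-commutativeMonoid
  using (sum; sum-syntax; ∑-distrib-+; sum-cong-≗; sum-replicate-zero)
open import Data.Nat.Tactic.RingSolver using (solve-∀)
open import Data.Product using (∃-syntax; _×_; _,_; proj₁; proj₂; uncurry)
open import Data.Sum using (_⊎_; inj₁; inj₂)
open import Function using (_∘_)
open import Relation.Binary.Definitions using (DecidableEquality; tri<; tri≈; tri>)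
open import Relation.Binary.PropositionalEquality
open import Relation.Nullary using (¬_; Dec; yes; no; contradiction)

private variable
  k l m n : ℕ
  a b c u v w : Fin n
  e x y z : LKVertex n
  S : List (LKVertex n)

δ : Fin k → Fin k → ℕ
δ zero    zero    = 1
δ zero    (suc _) = 0
δ (suc _) zero    = 0
δ (suc i) (suc j) = δ i j

δ-refl : (i : Fin k) → δ i i ≡ 1
δ-refl zero    = refl
δ-refl (suc i) = δ-refl i

δ-≢ : ∀ {i j : Fin k} → i ≢ j → δ i j ≡ 0
δ-≢ {i = zero}  {zero}  i≢j = contradiction refl i≢j
δ-≢ {i = zero}  {suc j} i≢j = refl
δ-≢ {i = suc i} {zero}  i≢j = refl
δ-≢ {i = suc i} {suc j} i≢j = δ-≢ (λ i≡j → i≢j (cong suc i≡j))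

∑-δ : (a : Fin k) → ∑[ v < k ] δ v a ≡ 1
∑-δ {suc k} zero    = cong suc (sum-replicate-zero k)
∑-δ {suc k} (suc a) = ∑-δ a

∑-ones : ∀ k → ∑[ v < k ] 1 ≡ k
∑-ones zero    = refl
∑-ones (suc k) = cong suc (∑-ones k)

∑-point : (f : Fin k → ℕ) (a : Fin k) → f a ≤ sum f
∑-point f zero    = ℕ.m≤m+n (f zero) _
∑-point f (suc a) = ℕ.≤-trans (∑-point (λ v → f (suc v)) a) (ℕ.m≤n+m _ (f zero))

∑-remove-one : (f : Fin k → ℕ) {a : Fin k} → 1 ≤ f a → sum f ≡ suc (∑[ v < k ] (f v ∸ δ v a))
∑-remove-one f {zero}  1≤fa = cong (_+ sum (λ v → f (suc v))) (sym (ℕ.m+[n∸m]≡n 1≤fa))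
∑-remove-one f {suc a} 1≤fa = trans (cong (f zero +_) (∑-remove-one (λ v → f (suc v)) 1≤fa)) (ℕ.+-suc (f zero) _)

∑-≥-distinct : (f : Fin k → ℕ) {ps : List (Fin k)} → Unique ps → All (λ p → 1 ≤ f p) ps → length ps ≤ sum f
∑-≥-distinct f [] [] = z≤n
∑-≥-distinct f {p ∷ ps} (p∉ps ∷ ps-unique) (1≤fp ∷ 1≤fps) =
  subst (suc (length ps) ≤_) (sym (∑-remove-one f 1≤fp))
    (s≤s (∑-≥-distinct _ ps-unique (All.zipWith (uncurry positive) (p∉ps , 1≤fps))))
  where
  positive : ∀ {q} → p ≢ q → 1 ≤ f q → 1 ≤ f q ∸ δ q p
  positive p≢q 1≤fq rewrite δ-≢ (λ q≡p → p≢q (sym q≡p)) = 1≤fq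

∑-1+ : (g : Fin k → ℕ) → ∑[ v < k ] (1 + g v) ≡ k + sum g
∑-1+ {k} g = trans (∑-distrib-+ (λ _ → 1) g) (cong (_+ sum g) (∑-ones k))

∑-excess : (f : Fin k → ℕ) → (∀ v → 1 ≤ f v) → sum f ≡ k + ∑[ v < k ] (f v ∸ 1)
∑-excess f 1≤f = trans (sum-cong-≗ (λ v → sym (ℕ.m+[n∸m]≡n (1≤f v)))) (∑-1+ (λ v → f v ∸ 1))

∑-excess-one-zero : (f : Fin k → ℕ) {u : Fin k} → f u ≡ 0 → (∀ v → v ≢ u → 1 ≤ f v) →
                    suc (sum f) ≡ k + ∑[ v < k ] (f v ∸ 1)
∑-excess-one-zero {k} f {u} fu≡0 1≤f = begin
  suc (sum f)               ≡⟨ ℕ.+-comm 1 (sum f) ⟩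
  sum f + 1                 ≡⟨ cong (sum f +_) (∑-δ u) ⟨
  sum f + ∑[ v < k ] δ v u  ≡⟨ ∑-distrib-+ f (λ v → δ v u) ⟨
  ∑[ v < k ] (f v + δ v u)  ≡⟨ sum-cong-≗ filled ⟩
  ∑[ v < k ] (1 + (f v ∸ 1)) ≡⟨ ∑-1+ (λ v → f v ∸ 1) ⟩
  k + ∑[ v < k ] (f v ∸ 1)  ∎
  where
  open ≡-Reasoning
  filled : ∀ v → f v + δ v u ≡ 1 + (f v ∸ 1)
  filled v with v F.≟ u
  ... | yes refl rewrite fu≡0 | δ-refl u = refl
  ... | no v≢u rewrite δ-≢ v≢u = trans (ℕ.+-identityʳ (f v)) (sym (ℕ.m+[n∸m]≡n (1≤f v v≢u)))

∑-nonzero : (f : Fin k → ℕ) → sum f ≢ 0 → ∃[ a ] f a ≢ 0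
∑-nonzero {zero}  f ∑f≢0 = contradiction refl ∑f≢0
∑-nonzero {suc k} f ∑f≢0 with f zero ℕ.≟ 0
... | no f0≢0 = zero , f0≢0
... | yes f0≡0 with ∑-nonzero (λ v → f (suc v)) (λ ∑≡0 → ∑f≢0 (cong₂ _+_ f0≡0 ∑≡0))
...   | a , fa≢0 = suc a , fa≢0

∑≡1⇒single : (f : Fin k → ℕ) → sum f ≡ 1 → ∃[ c ] (f c ≡ 1 × ∀ v → v ≢ c → f v ≡ 0)
∑≡1⇒single f ∑f≡1 with ∑-nonzero f (λ ∑f≡0 → ℕ.1+n≢0 (trans (sym ∑f≡1) ∑f≡0))
... | c , fc≢0 = c , ℕ.≤-antisym (subst (f c ≤_) ∑f≡1 (∑-point f c)) (ℕ.n≢0⇒n>0 fc≢0) , others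
  where
  others : ∀ v → v ≢ c → f v ≡ 0
  others v v≢c with f v ℕ.≟ 0
  ... | yes fv≡0 = fv≡0
  ... | no fv≢0 = contradiction
    (subst (2 ≤_) ∑f≡1 (∑-≥-distinct f ((v≢c ∷ []) ∷ [] ∷ []) (ℕ.n≢0⇒n>0 fv≢0 ∷ ℕ.n≢0⇒n>0 fc≢0 ∷ [])))
    λ { (s≤s ()) }

-- Graphs of diameter at most two

module DiameterTwo {V : Set} {Adj : V → V → Set} (_≟_ : DecidableEquality V)
  (adj-irrefl : ∀ {x} → ¬ Adj x x) (adj-sym : ∀ {x y} → Adj x y → Adj y x)
  (diameter≤2 : ∀ u v → ∃[ k ] (k ≤ 2 × GraphTheory.Walk Adj u v k)) where

  open GraphTheory Adj public
  open import Data.List.Membership.DecPropositional _≟_ using (_∈?_)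

  InducedP₃ : V → V → V → Set
  InducedP₃ x y z = Adj x y × Adj y z × x ≢ z × ¬ Adj x z

  HasInducedP₃ : List V → Set
  HasInducedP₃ S = ∃[ x ] ∃[ y ] ∃[ z ] (x ∈ S × y ∈ S × z ∈ S × InducedP₃ x y z)

  induced-P₃-reverse : ∀ {x y z} → InducedP₃ x y z → InducedP₃ z y x
  induced-P₃-reverse (xy , yz , x≢z , ¬xz) = adj-sym yz , adj-sym xy , ≢-sym x≢z , ¬xz ∘ adj-sym

  generalPosition⇒P₃-free : ∀ {S} → GeneralPosition S → ¬ HasInducedP₃ S
  generalPosition⇒P₃-free (_ , no-three) (x , y , z , x∈S , y∈S , z∈S , xy , yz , x≢z , ¬xz) =
    no-three x z 2 (xy ∷ yz ∷ []) shortest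
      (x , y , z , x≢y , x≢z , y≢z , x∈S , y∈S , z∈S , here refl , there (here refl) , there (there (here refl)))
    where
    x≢y : x ≢ y
    x≢y refl = adj-irrefl xy
    y≢z : y ≢ z
    y≢z refl = adj-irrefl yz
    shortest : Shortest (xy ∷ yz ∷ [])
    shortest zero [] = contradiction refl x≢z
    shortest (suc zero) (xz ∷ []) = contradiction xz ¬xz
    shortest (suc (suc _)) _ = s≤s (s≤s z≤n)

  private
    ∈-remove : ∀ {x a : V} {L} (a∈L : a ∈ L) → x ∈ L → x ≢ a → x ∈ L ─ a∈L
    ∈-remove (here refl) (here refl) x≢a = contradiction refl x≢a
    ∈-remove (here refl) (there x∈L) x≢a = x∈L
    ∈-remove (there a∈L) (here refl) x≢a = here refl
    ∈-remove (there a∈L) (there x∈L) x≢a = there (∈-remove a∈L x∈L x≢a)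

    not-three-in-two : ∀ {a b x y z : V} → x ≢ y → x ≢ z → y ≢ z →
                       x ∈ a ∷ b ∷ [] → y ∈ a ∷ b ∷ [] → z ∈ a ∷ b ∷ [] → ⊥
    not-three-in-two x≢y x≢z y≢z (here refl) (here refl) _ = x≢y refl
    not-three-in-two x≢y x≢z y≢z (there (here refl)) (there (here refl)) _ = x≢y refl
    not-three-in-two x≢y x≢z y≢z (here refl) (there (here refl)) (here refl) = x≢z refl
    not-three-in-two x≢y x≢z y≢z (here refl) (there (here refl)) (there (here refl)) = y≢z refl
    not-three-in-two x≢y x≢z y≢z (there (here refl)) (here refl) (here refl) = y≢z refl
    not-three-in-two x≢y x≢z y≢z (there (here refl)) (here refl) (there (here refl)) = x≢z refl

    one-of-three : ∀ {a b c x y z t : V} → x ≢ y → x ≢ z → y ≢ z →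
                   x ∈ a ∷ b ∷ c ∷ [] → y ∈ a ∷ b ∷ c ∷ [] → z ∈ a ∷ b ∷ c ∷ [] →
                   t ∈ a ∷ b ∷ c ∷ [] → t ≡ x ⊎ t ≡ y ⊎ t ≡ z
    one-of-three {a} {b} {c} {x} {y} {z} {t} x≢y x≢z y≢z x∈ y∈ z∈ t∈ with t ≟ x | t ≟ y | t ≟ z
    ... | yes t≡x | _ | _ = inj₁ t≡x
    ... | no _ | yes t≡y | _ = inj₂ (inj₁ t≡y)
    ... | no _ | no _ | yes t≡z = inj₂ (inj₂ t≡z)
    ... | no t≢x | no t≢y | no t≢z =
      ⊥-elim (rest-too-short t∈ (∈-remove t∈ x∈ (≢-sym t≢x)) (∈-remove t∈ y∈ (≢-sym t≢y)) (∈-remove t∈ z∈ (≢-sym t≢z)))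
      where
      rest-too-short : (t∈ : t ∈ a ∷ b ∷ c ∷ []) → let L = (a ∷ b ∷ c ∷ []) ─ t∈ in x ∈ L → y ∈ L → z ∈ L → ⊥
      rest-too-short (here refl) = not-three-in-two x≢y x≢z y≢z
      rest-too-short (there (here refl)) = not-three-in-two x≢y x≢z y≢z
      rest-too-short (there (there (here refl))) = not-three-in-two x≢y x≢z y≢z

  P₃-free⇒generalPosition : ∀ {S} → Unique S → ¬ HasInducedP₃ S → GeneralPosition S
  P₃-free⇒generalPosition {S} unique P₃-free = unique , no-three
    where
    no-three : ∀ u v k (p : Walk u v k) → Shortest p →
               ¬ (∃[ x ] ∃[ y ] ∃[ z ] (x ≢ y × x ≢ z × y ≢ z × x ∈ S × y ∈ S × z ∈ S ×
                                         x ∈ verts p × y ∈ verts p × z ∈ verts p))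
    no-three u v _ [] _ (x , y , z , x≢y , _ , _ , _ , _ , _ , here refl , here refl , _) = x≢y refl
    no-three u v _ (_ ∷ []) _ (x , y , z , x≢y , x≢z , y≢z , _ , _ , _ , x∈p , y∈p , z∈p) =
      not-three-in-two x≢y x≢z y≢z x∈p y∈p z∈p
    no-three u v _ (_∷_ {w = w} uw (wv ∷ [])) shortest
             (x , y , z , x≢y , x≢z , y≢z , x∈S , y∈S , z∈S , x∈p , y∈p , z∈p) =
      P₃-free (u , w , v , in-S (here refl) , in-S (there (here refl)) , in-S (there (there (here refl))) ,
               uw , wv , u≢v , ¬uv)
      where
      in-S : ∀ {t} → t ∈ u ∷ w ∷ v ∷ [] → t ∈ S
      in-S t∈p with one-of-three x≢y x≢z y≢z x∈p y∈p z∈p t∈p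
      ... | inj₁ refl = x∈S
      ... | inj₂ (inj₁ refl) = y∈S
      ... | inj₂ (inj₂ refl) = z∈S
      u≢v : u ≢ v
      u≢v refl with shortest 0 []
      ... | ()
      ¬uv : ¬ Adj u v
      ¬uv uv with shortest 1 (uv ∷ [])
      ... | s≤s ()
    no-three u v _ (_ ∷ _ ∷ _ ∷ _) shortest _ with diameter≤2 u v
    ... | k , k≤2 , walk with ℕ.≤-trans (shortest k walk) k≤2
    ...   | s≤s (s≤s ())

  maximal-if-outsiders-are-P₃-centres : ∀ {S} → GeneralPosition S →
    (∀ t → t ∉ S → ∃[ x ] ∃[ z ] (x ∈ S × z ∈ S × InducedP₃ x t z)) → MaximalGP S
  maximal-if-outsiders-are-P₃-centres {S} gpS centre = gpS , T⊆S
    where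
    T⊆S : ∀ T → GeneralPosition T → S ⊆ T → T ⊆ S
    T⊆S T gpT S⊆T t t∈T with t ∈? S
    ... | yes t∈S = t∈S
    ... | no t∉S with centre t t∉S
    ...   | x , z , x∈S , z∈S , P₃ =
      contradiction (x , t , z , S⊆T x x∈S , t∈T , S⊆T z z∈S , P₃) (generalPosition⇒P₃-free gpT)

  P₃-through : V → List V → Set
  P₃-through t S = (∃[ y ] ∃[ z ] (y ∈ S × z ∈ S × InducedP₃ t y z))
                 ⊎ (∃[ x ] ∃[ z ] (x ∈ S × z ∈ S × InducedP₃ x t z))

  maximal⇒outsider-on-P₃ : ∀ {S t} → MaximalGP S → t ∉ S → ¬ ¬ P₃-through t S
  maximal⇒outsider-on-P₃ {S} {t} (gpS , maximal) t∉S no-P₃-through =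
    t∉S (maximal (t ∷ S) (P₃-free⇒generalPosition (¬Any⇒All¬ S t∉S ∷ proj₁ gpS) P₃-free) (λ _ → there) t (here refl))
    where
    P₃-free : ¬ HasInducedP₃ (t ∷ S)
    P₃-free (x , y , z , there x∈S , there y∈S , there z∈S , P₃) = generalPosition⇒P₃-free gpS (x , y , z , x∈S , y∈S , z∈S , P₃)
    P₃-free (x , y , z , here refl , there y∈S , there z∈S , P₃) = no-P₃-through (inj₁ (y , z , y∈S , z∈S , P₃))
    P₃-free (x , y , z , there x∈S , here refl , there z∈S , P₃) = no-P₃-through (inj₂ (x , z , x∈S , z∈S , P₃))
    P₃-free (x , y , z , there x∈S , there y∈S , here refl , P₃) =
      no-P₃-through (inj₁ (y , x , y∈S , x∈S , induced-P₃-reverse P₃))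
    P₃-free (x , y , z , here refl , here refl , _ , xy , _) = adj-irrefl xy
    P₃-free (x , y , z , _ , here refl , here refl , _ , yz , _) = adj-irrefl yz
    P₃-free (x , y , z , here refl , there _ , here refl , _ , _ , x≢z , _) = x≢z refl

-- The line graph of K_n

data _∈ₑ_ {n} : Fin n → LKVertex n → Set where
  start : ∀ {i j} {i<j : i F.< j} → i ∈ₑ ((i , j) , i<j)
  end   : ∀ {i j} {i<j : i F.< j} → j ∈ₑ ((i , j) , i<j)

_∈ₑ?_ : (w : Fin n) (e : LKVertex n) → Dec (w ∈ₑ e)
w ∈ₑ? ((i , j) , _) with w F.≟ i | w F.≟ j
... | yes refl | _        = yes start
... | no _     | yes refl = yes end
... | no w≢i   | no w≢j   = no λ { start → w≢i refl ; end → w≢j refl }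

Meets : LKVertex n → LKVertex n → Set
Meets x y = ∃[ w ] (w ∈ₑ x × w ∈ₑ y)

meets-refl : (x : LKVertex n) → Meets x x
meets-refl _ = _ , start , start

meets-sym : {x y : LKVertex n} → Meets x y → Meets y x
meets-sym (w , w∈x , w∈y) = w , w∈y , w∈x

edge-ext : ∀ {i j k l : Fin n} {i<j : i F.< j} {k<l : k F.< l} → i ≡ k → j ≡ l →
           _≡_ {A = LKVertex n} ((i , j) , i<j) ((k , l) , k<l)
edge-ext {i<j = i<j} {k<l} refl refl = cong ((_ , _) ,_) (ℕ.<-irrelevant i<j k<l)

_≟ₑ_ : DecidableEquality (LKVertex n)
((i , j) , _) ≟ₑ ((k , l) , _) with i F.≟ k | j F.≟ l
... | yes i≡k | yes j≡l = yes (edge-ext i≡k j≡l)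
... | no i≢k  | _       = no λ x≡y → i≢k (cong (λ e → proj₁ (proj₁ e)) x≡y)
... | yes _   | no j≢l  = no λ x≡y → j≢l (cong (λ e → proj₂ (proj₁ e)) x≡y)

edge-unique : ∀ {a b : Fin n} {x y} → a ≢ b → a ∈ₑ x → b ∈ₑ x → a ∈ₑ y → b ∈ₑ y → x ≡ y
edge-unique {a = a} {b} {x = (i , j) , i<j} {(k , l) , k<l} a≢b = cases
  where
  cases : a ∈ₑ ((i , j) , i<j) → b ∈ₑ ((i , j) , i<j) → a ∈ₑ ((k , l) , k<l) → b ∈ₑ ((k , l) , k<l) →
          ((i , j) , i<j) ≡ ((k , l) , k<l)
  cases start start _     _     = contradiction refl a≢b
  cases end   end   _     _     = contradiction refl a≢b
  cases _     _     start start = contradiction refl a≢b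
  cases _     _     end   end   = contradiction refl a≢b
  cases start end   start end   = edge-ext refl refl
  cases end   start end   start = edge-ext refl refl
  cases start end   end   start = contradiction i<j (ℕ.<-asym k<l)
  cases end   start start end   = contradiction i<j (ℕ.<-asym k<l)

ends-distinct : (e : LKVertex n) → proj₁ (proj₁ e) ≢ proj₂ (proj₁ e)
ends-distinct (_ , i<j) i≡j = ℕ.<-irrefl (cong F.toℕ i≡j) i<j

no-third-end : ∀ {a b c : Fin n} {x} → a ≢ b → a ≢ c → b ≢ c → a ∈ₑ x → b ∈ₑ x → c ∈ₑ x → ⊥
no-third-end a≢b a≢c b≢c start start _     = a≢b refl
no-third-end a≢b a≢c b≢c end   end   _     = a≢b refl
no-third-end a≢b a≢c b≢c start end   start = a≢c refl
no-third-end a≢b a≢c b≢c start end   end   = b≢c refl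
no-third-end a≢b a≢c b≢c end   start start = b≢c refl
no-third-end a≢b a≢c b≢c end   start end   = a≢c refl

end-is-one-of : ∀ {u v w : Fin n} {x} → u ≢ v → u ∈ₑ x → v ∈ₑ x → w ∈ₑ x → w ≡ u ⊎ w ≡ v
end-is-one-of {u = u} {v} {w} {x} u≢v u∈x v∈x w∈x with w F.≟ u | w F.≟ v
... | yes w≡u | _       = inj₁ w≡u
... | no _    | yes w≡v = inj₂ w≡v
... | no w≢u  | no w≢v  = ⊥-elim (no-third-end {x = x} u≢v (≢-sym w≢u) (≢-sym w≢v) u∈x v∈x w∈x)

other-end : ∀ {c : Fin n} {x} → c ∈ₑ x → ∃[ a ] (a ≢ c × a ∈ₑ x)
other-end {x = x} start = _ , ≢-sym (ends-distinct x) , end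
other-end {x = x} end   = _ , ends-distinct x , start

edge-through : {a b : Fin n} → a ≢ b → ∃[ e ] (a ∈ₑ e × b ∈ₑ e)
edge-through {a = a} {b} a≢b with F.<-cmp a b
... | tri< a<b _ _ = ((a , b) , a<b) , start , end
... | tri≈ _ a≡b _ = contradiction a≡b a≢b
... | tri> _ _ b<a = ((b , a) , b<a) , end , start

adj⇒meets : {x y : LKVertex n} → LKAdj x y → Meets x y
adj⇒meets (_ , inj₁ refl)               = _ , start , start
adj⇒meets (_ , inj₂ (inj₁ refl))        = _ , start , end
adj⇒meets (_ , inj₂ (inj₂ (inj₁ refl))) = _ , end   , start
adj⇒meets (_ , inj₂ (inj₂ (inj₂ refl))) = _ , end   , end

meets⇒adj : {x y : LKVertex n} → x ≢ y → Meets x y → LKAdj x y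
meets⇒adj x≢y (_ , start , start) = x≢y , inj₁ refl
meets⇒adj x≢y (_ , start , end)   = x≢y , inj₂ (inj₁ refl)
meets⇒adj x≢y (_ , end   , start) = x≢y , inj₂ (inj₂ (inj₁ refl))
meets⇒adj x≢y (_ , end   , end)   = x≢y , inj₂ (inj₂ (inj₂ refl))

adj-irrefl : {x : LKVertex n} → ¬ LKAdj x x
adj-irrefl (x≢x , _) = x≢x refl

adj-sym : {x y : LKVertex n} → LKAdj x y → LKAdj y x
adj-sym {x = x} {y} xy@(x≢y , _) = meets⇒adj (≢-sym x≢y) (meets-sym {x = x} {y} (adj⇒meets xy))

meets? : (x y : LKVertex n) → Dec (Meets x y)
meets? ((i , j) , _) y with i ∈ₑ? y | j ∈ₑ? y
... | yes i∈y | _       = yes (i , start , i∈y)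
... | no _    | yes j∈y = yes (j , end , j∈y)
... | no i∉y  | no j∉y  = no λ { (_ , start , i∈y) → i∉y i∈y ; (_ , end , j∈y) → j∉y j∈y }

module _ {n : ℕ} where
  open GraphTheory (LKAdj {n}) using (Walk; []; _∷_)

  distance≤2 : (u v : LKVertex n) → ∃[ k ] (k ≤ 2 × Walk u v k)
  distance≤2 u v with u ≟ₑ v
  ... | yes refl = 0 , z≤n , []
  ... | no u≢v with meets? u v
  ...   | yes u~v = 1 , s≤s z≤n , meets⇒adj u≢v u~v ∷ []
  ...   | no u≁v with edge-through i≢k
    where
    i≢k : proj₁ (proj₁ u) ≢ proj₁ (proj₁ v)
    i≢k refl = u≁v (_ , start , start)
  ...     | e , i∈e , k∈e = 2 , ℕ.≤-refl , (meets⇒adj u≢e (_ , start , i∈e) ∷ (meets⇒adj e≢v (_ , k∈e , start) ∷ []))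
    where
    u≢e : u ≢ e
    u≢e refl = u≁v (_ , k∈e , start)
    e≢v : e ≢ v
    e≢v refl = u≁v (_ , start , i∈e)

another-point : 2 ≤ n → (u : Fin n) → ∃[ v ] v ≢ u
another-point (s≤s (s≤s _)) F.zero    = F.suc F.zero , λ ()
another-point (s≤s (s≤s _)) (F.suc _) = F.zero , λ ()

module LK {n : ℕ} = DiameterTwo (_≟ₑ_ {n}) adj-irrefl adj-sym distance≤2
open LK

induced-P₃ : x ≢ y → y ≢ z → Meets x y → Meets y z → ¬ Meets x z → InducedP₃ x y z
induced-P₃ {x = x} x≢y y≢z x~y y~z x≁z =
  meets⇒adj x≢y x~y , meets⇒adj y≢z y~z , (λ { refl → x≁z (meets-refl x) }) , λ x-z → x≁z (adj⇒meets x-z)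

P₃-ends-disjoint : InducedP₃ x y z → ¬ Meets x z
P₃-ends-disjoint (_ , _ , x≢z , ¬x-z) x~z = ¬x-z (meets⇒adj x≢z x~z)

-- Degrees

incidence : Fin n → LKVertex n → ℕ
incidence w ((i , j) , _) = δ w i + δ w j

degree : Fin n → List (LKVertex n) → ℕ
degree w []      = 0
degree w (e ∷ S) = incidence w e + degree w S

∑-incidence : (e : LKVertex n) → ∑[ w < n ] incidence w e ≡ 2
∑-incidence ((i , j) , _) = trans (∑-distrib-+ (λ w → δ w i) (λ w → δ w j)) (cong₂ _+_ (∑-δ i) (∑-δ j))

handshake : (S : List (LKVertex n)) → ∑[ w < n ] degree w S ≡ 2 * length S
handshake {n} []      = sum-replicate-zero n
handshake {n} (e ∷ S) = begin
  ∑[ w < n ] (incidence w e + degree w S)          ≡⟨ ∑-distrib-+ (λ w → incidence w e) (λ w → degree w S) ⟩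
  ∑[ w < n ] incidence w e + ∑[ w < n ] degree w S ≡⟨ cong₂ _+_ (∑-incidence e) (handshake S) ⟩
  2 + 2 * length S                                 ≡⟨ ℕ.*-suc 2 (length S) ⟨
  2 * length (e ∷ S)                               ∎
  where open ≡-Reasoning

incidence-end : w ∈ₑ e → incidence w e ≡ 1
incidence-end {e = e@((i , j) , _)} start rewrite δ-refl i | δ-≢ (ends-distinct e) = refl
incidence-end {e = e@((i , j) , _)} end   rewrite δ-refl j | δ-≢ (≢-sym (ends-distinct e)) = refl

incidence-non-end : ¬ w ∈ₑ e → incidence w e ≡ 0
incidence-non-end {w = w} {e = (i , j) , _} w∉e = cong₂ _+_ (δ-≢ w≢i) (δ-≢ w≢j)
  where
  w≢i : w ≢ i
  w≢i refl = w∉e start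
  w≢j : w ≢ j
  w≢j refl = w∉e end

degree-∷-end : w ∈ₑ e → degree w (e ∷ S) ≡ suc (degree w S)
degree-∷-end {w = w} {e} {S} w∈e = cong (_+ degree w S) (incidence-end {e = e} w∈e)

degree-∷ : ∀ w e (S : List (LKVertex n)) → degree w S ≤ degree w (e ∷ S)
degree-∷ w e S = ℕ.m≤n+m (degree w S) (incidence w e)

degree-head : ∀ S {k} → w ∈ₑ e → k ≤ degree w S → suc k ≤ degree w (e ∷ S)
degree-head S {k} w∈e k≤d = subst (suc k ≤_) (sym (degree-∷-end {S = S} w∈e)) (s≤s k≤d)

degree-≥1 : e ∈ S → w ∈ₑ e → 1 ≤ degree w S
degree-≥1 {S = _ ∷ S} (here refl) w∈e = degree-head S w∈e z≤n
degree-≥1 {S = x ∷ S} {w = w} (there e∈S) w∈e = ℕ.≤-trans (degree-≥1 e∈S w∈e) (degree-∷ w x S)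

degree-≥2 : x ∈ S → y ∈ S → x ≢ y → w ∈ₑ x → w ∈ₑ y → 2 ≤ degree w S
degree-≥2 (here refl) (here refl) x≢y _ _ = contradiction refl x≢y
degree-≥2 {S = _ ∷ S} (here refl) (there y∈S) _ w∈x w∈y = degree-head S w∈x (degree-≥1 y∈S w∈y)
degree-≥2 {S = _ ∷ S} (there x∈S) (here refl) _ w∈x w∈y = degree-head S w∈y (degree-≥1 x∈S w∈x)
degree-≥2 {S = e ∷ S} {w = w} (there x∈S) (there y∈S) x≢y w∈x w∈y =
  ℕ.≤-trans (degree-≥2 x∈S y∈S x≢y w∈x w∈y) (degree-∷ w e S)

degree-≥3 : x ∈ S → y ∈ S → z ∈ S → x ≢ y → x ≢ z → y ≢ z → w ∈ₑ x → w ∈ₑ y → w ∈ₑ z → 3 ≤ degree w S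
degree-≥3 (here refl) (here refl) _ x≢y _ _ _ _ _ = contradiction refl x≢y
degree-≥3 (here refl) _ (here refl) _ x≢z _ _ _ _ = contradiction refl x≢z
degree-≥3 _ (here refl) (here refl) _ _ y≢z _ _ _ = contradiction refl y≢z
degree-≥3 {S = _ ∷ S} (here refl) (there y∈S) (there z∈S) _ _ y≢z w∈x w∈y w∈z =
  degree-head S w∈x (degree-≥2 y∈S z∈S y≢z w∈y w∈z)
degree-≥3 {S = _ ∷ S} (there x∈S) (here refl) (there z∈S) _ x≢z _ w∈x w∈y w∈z =
  degree-head S w∈y (degree-≥2 x∈S z∈S x≢z w∈x w∈z)
degree-≥3 {S = _ ∷ S} (there x∈S) (there y∈S) (here refl) x≢y _ _ w∈x w∈y w∈z =
  degree-head S w∈z (degree-≥2 x∈S y∈S x≢y w∈x w∈y)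
degree-≥3 {S = e ∷ S} {w = w} (there x∈S) (there y∈S) (there z∈S) x≢y x≢z y≢z w∈x w∈y w∈z =
  ℕ.≤-trans (degree-≥3 x∈S y∈S z∈S x≢y x≢z y≢z w∈x w∈y w∈z) (degree-∷ w e S)

degree-≥1⇒edge : 1 ≤ degree w S → ∃[ e ] (e ∈ S × w ∈ₑ e)
degree-≥1⇒edge {w = w} {S = e ∷ S} 1≤d with w ∈ₑ? e
... | yes w∈e = e , here refl , w∈e
... | no w∉e with degree-≥1⇒edge {S = S} (subst (λ k → 1 ≤ k + degree w S) (incidence-non-end {e = e} w∉e) 1≤d)
...   | f , f∈S , w∈f = f , there f∈S , w∈f

degree-≥2⇒another-edge : Unique S → 2 ≤ degree w S → ∀ y → ∃[ e ] (e ∈ S × e ≢ y × w ∈ₑ e)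
degree-≥2⇒another-edge {S = e ∷ S} {w = w} (e∉S ∷ S-unique) 2≤d y with w ∈ₑ? e
... | yes w∈e with e ≟ₑ y | degree-≥1⇒edge {S = S} (ℕ.≤-pred (subst (2 ≤_) (degree-∷-end {S = S} w∈e) 2≤d))
...   | no e≢y  | _ = e , here refl , e≢y , w∈e
...   | yes refl | f , f∈S , w∈f = f , there f∈S , ≢-sym (All.lookup e∉S f∈S) , w∈f
degree-≥2⇒another-edge {S = e ∷ S} {w = w} (_ ∷ S-unique) 2≤d y | no w∉e
  with degree-≥2⇒another-edge S-unique (subst (λ k → 2 ≤ k + degree w S) (incidence-non-end {e = e} w∉e) 2≤d) y
... | f , f∈S , f≢y , w∈f = f , there f∈S , f≢y , w∈f

isolated-no-edge : degree u S ≡ 0 → e ∈ S → ¬ u ∈ₑ e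
isolated-no-edge du≡0 e∈S u∈e with subst (1 ≤_) du≡0 (degree-≥1 e∈S u∈e)
... | ()

sole-edge : degree w S < 2 → x ∈ S → w ∈ₑ x → y ∈ S → w ∈ₑ y → y ≡ x
sole-edge {x = x} {y = y} dw<2 x∈S w∈x y∈S w∈y with y ≟ₑ x
... | yes y≡x = y≡x
... | no y≢x  = contradiction (degree-≥2 y∈S x∈S y≢x w∈y w∈x) (ℕ.<⇒≱ dw<2)

-- Lower bounds

covered-except-isolated : MaximalGP S → degree u S ≡ 0 → v ≢ u → 1 ≤ degree v S
covered-except-isolated {S = S} {u} {v} max du≡0 v≢u with degree v S ℕ.≟ 0
... | no dv≢0 = ℕ.n≢0⇒n>0 dv≢0
... | yes dv≡0 with edge-through v≢u
...   | t , v∈t , u∈t = ⊥-elim (maximal⇒outsider-on-P₃ max t∉S on-P₃)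
  where
  untouched : ∀ {x} → x ∈ S → ¬ Meets x t
  untouched x∈S (w , w∈x , w∈t) with end-is-one-of v≢u v∈t u∈t w∈t
  ... | inj₁ refl = isolated-no-edge dv≡0 x∈S w∈x
  ... | inj₂ refl = isolated-no-edge du≡0 x∈S w∈x
  t∉S : t ∉ S
  t∉S t∈S = untouched t∈S (meets-refl t)
  on-P₃ : ¬ P₃-through t S
  on-P₃ (inj₁ (y , _ , y∈S , _ , t-y , _)) = untouched y∈S (meets-sym (adj⇒meets t-y))
  on-P₃ (inj₂ (x , _ , x∈S , _ , x-t , _)) = untouched x∈S (adj⇒meets x-t)

-- Adding the edge uv creates an induced path; as u is isolated, it is uv – y – z with v on y, and the
-- common end of y and z has degree at least 2.
edge-to-hub : MaximalGP S → degree u S ≡ 0 → v ≢ u →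
             ¬ ¬ (∃[ y ] ∃[ c ] (y ∈ S × v ∈ₑ y × c ∈ₑ y × c ≢ v × 2 ≤ degree c S))
edge-to-hub {S = S} {u} {v} max du≡0 v≢u no-hub with edge-through v≢u
... | t , v∈t , u∈t = maximal⇒outsider-on-P₃ max t∉S on-P₃
  where
  through-v : ∀ {x} → x ∈ S → Meets x t → v ∈ₑ x
  through-v x∈S (w , w∈x , w∈t) with end-is-one-of v≢u v∈t u∈t w∈t
  ... | inj₁ refl = w∈x
  ... | inj₂ refl = ⊥-elim (isolated-no-edge du≡0 x∈S w∈x)
  t∉S : t ∉ S
  t∉S t∈S = isolated-no-edge du≡0 t∈S u∈t
  on-P₃ : ¬ P₃-through t S
  on-P₃ (inj₁ (y , z , y∈S , z∈S , P₃@(t-y , y-z , _))) with adj⇒meets y-z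
  ... | w , w∈y , w∈z = no-hub (y , w , y∈S , v∈y , w∈y , w≢v , degree-≥2 y∈S z∈S (proj₁ y-z) w∈y w∈z)
    where
    v∈y : v ∈ₑ y
    v∈y = through-v y∈S (meets-sym (adj⇒meets t-y))
    w≢v : w ≢ v
    w≢v refl = P₃-ends-disjoint P₃ (w , v∈t , w∈z)
  on-P₃ (inj₂ (x , z , x∈S , z∈S , P₃@(x-t , t-z , _))) =
    P₃-ends-disjoint P₃ (v , through-v x∈S (adj⇒meets x-t) , through-v z∈S (meets-sym (adj⇒meets t-z)))

-- Further edges f at c and g at d either share their other end, or form the induced path f – y – g.
adjacent-hubs⇒third-hub : ∀ {d} → Unique S → ¬ HasInducedP₃ S → y ∈ S → c ∈ₑ y → d ∈ₑ y → c ≢ d →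
                          2 ≤ degree c S → 2 ≤ degree d S → ∃[ e ] (e ≢ c × e ≢ d × 2 ≤ degree e S)
adjacent-hubs⇒third-hub {S = S} {y = y} {c} {d} unique P₃-free y∈S c∈y d∈y c≢d 2≤dc 2≤dd
  with degree-≥2⇒another-edge unique 2≤dc y | degree-≥2⇒another-edge unique 2≤dd y
... | f , f∈S , f≢y , c∈f | g , g∈S , g≢y , d∈g with other-end c∈f | other-end d∈g
...   | a , a≢c , a∈f | b , b≢d , b∈g = third-end
  where
  a≢d : a ≢ d
  a≢d refl = f≢y (edge-unique c≢d c∈f a∈f c∈y d∈y)
  b≢c : b ≢ c
  b≢c refl = g≢y (edge-unique c≢d b∈g d∈g c∈y d∈y)
  third-end : ∃[ e ] (e ≢ c × e ≢ d × 2 ≤ degree e S)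
  third-end with a F.≟ b
  ... | yes refl = a , a≢c , a≢d , degree-≥2 f∈S g∈S f≢g a∈f b∈g
    where
    f≢g : f ≢ g
    f≢g refl = no-third-end {x = f} c≢d (≢-sym a≢c) (≢-sym a≢d) c∈f d∈g a∈f
  ... | no a≢b = contradiction (f , y , g , f∈S , y∈S , g∈S , P₃) P₃-free
    where
    f≁g : ¬ Meets f g
    f≁g (w , w∈f , w∈g) with end-is-one-of (≢-sym a≢c) c∈f a∈f w∈f | end-is-one-of (≢-sym b≢d) d∈g b∈g w∈g
    ... | inj₁ refl | inj₁ refl = c≢d refl
    ... | inj₁ refl | inj₂ refl = b≢c refl
    ... | inj₂ refl | inj₁ refl = a≢d refl
    ... | inj₂ refl | inj₂ refl = a≢b refl
    P₃ : InducedP₃ f y g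
    P₃ = induced-P₃ {x = f} {y} {g} f≢y (≢-sym g≢y) (c , c∈f , c∈y) (d , d∈y , d∈g) f≁g

-- Only x and z meet the edge ab, and they meet each other at c, so ab can be added to S.
cherry-extends : MaximalGP S → x ∈ S → z ∈ S → c ∈ₑ x → c ∈ₑ z → a ∈ₑ x → b ∈ₑ z → a ≢ c → b ≢ c → a ≢ b →
                 degree a S < 2 → degree b S < 2 → degree c S < 3 → ⊥
cherry-extends {S = S} {x = x} {z} {c} {a} {b} max x∈S z∈S c∈x c∈z a∈x b∈z a≢c b≢c a≢b da<2 db<2 dc<3
  with edge-through a≢b
... | t , a∈t , b∈t = maximal⇒outsider-on-P₃ max t∉S on-P₃
  where
  x≢z : x ≢ z
  x≢z refl = no-third-end {x = x} a≢b a≢c b≢c a∈x b∈z c∈x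
  touching : ∀ {y} → y ∈ S → Meets y t → y ≡ x ⊎ y ≡ z
  touching y∈S (w , w∈y , w∈t) with end-is-one-of a≢b a∈t b∈t w∈t
  ... | inj₁ refl = inj₁ (sole-edge da<2 x∈S a∈x y∈S w∈y)
  ... | inj₂ refl = inj₂ (sole-edge db<2 z∈S b∈z y∈S w∈y)
  centre-on-touching : ∀ {y} → y ∈ S → Meets y t → c ∈ₑ y
  centre-on-touching y∈S y~t with touching y∈S y~t
  ... | inj₁ refl = c∈x
  ... | inj₂ refl = c∈z
  t∉S : t ∉ S
  t∉S t∈S with touching t∈S (meets-refl t)
  ... | inj₁ refl = no-third-end {x = x} a≢b a≢c b≢c a∈x b∈t c∈x
  ... | inj₂ refl = no-third-end {x = z} a≢b a≢c b≢c a∈t b∈z c∈z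
  leaf : ∀ {p y z′} → p ∈ₑ y → c ∈ₑ y → p ≢ c → p ∈ₑ t → z′ ∈ S → Meets y z′ → ¬ Meets t z′ → ⊥
  leaf {z′ = z′} p∈y c∈y p≢c p∈t z′∈S (w , w∈y , w∈z′) t≁z′ with end-is-one-of p≢c p∈y c∈y w∈y
  ... | inj₁ refl = t≁z′ (w , p∈t , w∈z′)
  ... | inj₂ refl = ℕ.<⇒≱ dc<3 (degree-≥3 x∈S z∈S z′∈S x≢z x≢z′ z≢z′ c∈x c∈z w∈z′)
    where
    x≢z′ : x ≢ z′
    x≢z′ refl = t≁z′ (a , a∈t , a∈x)
    z≢z′ : z ≢ z′
    z≢z′ refl = t≁z′ (b , b∈t , b∈z)
  on-P₃ : ¬ P₃-through t S
  on-P₃ (inj₁ (y , z′ , y∈S , z′∈S , P₃@(t-y , y-z′ , _))) with touching y∈S (meets-sym (adj⇒meets t-y))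
  ... | inj₁ refl = leaf a∈x c∈x a≢c a∈t z′∈S (adj⇒meets y-z′) (P₃-ends-disjoint P₃)
  ... | inj₂ refl = leaf b∈z c∈z b≢c b∈t z′∈S (adj⇒meets y-z′) (P₃-ends-disjoint P₃)
  on-P₃ (inj₂ (y , z′ , y∈S , z′∈S , P₃@(y-t , t-z′ , _))) =
    P₃-ends-disjoint P₃ (c , centre-on-touching y∈S (adj⇒meets y-t) , centre-on-touching z′∈S (meets-sym (adj⇒meets t-z′)))

excess-bound : ∀ {r l m E} → r + 2 * l ≡ (2 * m + 1) + E → l ≤ suc m → E ≤ suc r
excess-bound {r} {l} {m} {E} balance l≤1+m = ℕ.+-cancelˡ-≤ (2 * m + 1) E (suc r) (begin
  (2 * m + 1) + E      ≡⟨ balance ⟨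
  r + 2 * l            ≤⟨ ℕ.+-monoʳ-≤ r (ℕ.*-monoʳ-≤ 2 l≤1+m) ⟩
  r + 2 * suc m        ≡⟨ rearrange r m ⟩
  (2 * m + 1) + suc r  ∎)
  where
  open ℕ.≤-Reasoning
  rearrange : ∀ r m → r + 2 * suc m ≡ (2 * m + 1) + suc r
  rearrange = solve-∀

surplus : List (LKVertex n) → Fin n → ℕ
surplus S v = degree v S ∸ 1

handshake-surplus : {S : List (LKVertex n)} → (∀ v → 1 ≤ degree v S) → 2 * length S ≡ n + sum (surplus S)
handshake-surplus {S = S} covered = trans (sym (handshake S)) (∑-excess _ covered)

handshake-surplus-isolated : {S : List (LKVertex n)} → degree u S ≡ 0 → (∀ v → v ≢ u → 1 ≤ degree v S) →
                             suc (2 * length S) ≡ n + sum (surplus S)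
handshake-surplus-isolated {S = S} du≡0 covered = trans (cong suc (sym (handshake S))) (∑-excess-one-zero _ du≡0 covered)

single-hub : {S : List (LKVertex n)} → n ≡ 2 * m + 1 → length S ≤ suc m → (∀ v → 1 ≤ degree v S) →
             ∃[ c ] (degree c S ≡ 2 × ∀ v → v ≢ c → degree v S ≡ 1)
single-hub {n = n} {m = m} {S} n≡2m+1 l≤1+m covered =
  let c , sc≡1 , others≡0 = ∑≡1⇒single (surplus S) E≡1
  in c , from-surplus sc≡1 , λ v v≢c → from-surplus (others≡0 v v≢c)
  where
  balance : 0 + 2 * length S ≡ (2 * m + 1) + sum (surplus S)
  balance = trans (handshake-surplus {S = S} covered) (cong (_+ sum (surplus S)) n≡2m+1)
  E≢0 : sum (surplus S) ≢ 0
  E≢0 E≡0 = ℕ.even≢odd (length S) m (begin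
    2 * length S                ≡⟨ balance ⟩
    2 * m + 1 + sum (surplus S) ≡⟨ cong (2 * m + 1 +_) E≡0 ⟩
    2 * m + 1 + 0               ≡⟨ trans (ℕ.+-identityʳ _) (ℕ.+-comm (2 * m) 1) ⟩
    suc (2 * m)                 ∎)
    where open ≡-Reasoning
  E≡1 : sum (surplus S) ≡ 1
  E≡1 = ℕ.≤-antisym (excess-bound balance l≤1+m) (ℕ.n≢0⇒n>0 E≢0)
  from-surplus : ∀ {v k} → surplus S v ≡ k → degree v S ≡ suc k
  from-surplus {v} refl = sym (ℕ.m+[n∸m]≡n (covered v))

three-hubs-too-many : {S : List (LKVertex n)} → n ≡ 2 * m + 1 → length S ≤ suc m → degree u S ≡ 0 → (∀ v → v ≢ u → 1 ≤ degree v S) →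
                      a ≢ b → a ≢ c → b ≢ c → 2 ≤ degree a S → 2 ≤ degree b S → 2 ≤ degree c S → ⊥
three-hubs-too-many {n = n} {m = m} {S = S} n≡2m+1 l≤1+m du≡0 covered a≢b a≢c b≢c 2≤da 2≤db 2≤dc =
  ℕ.<⇒≱ (s≤s (excess-bound balance l≤1+m))
    (∑-≥-distinct (surplus S) ((a≢b ∷ a≢c ∷ []) ∷ (b≢c ∷ []) ∷ [] ∷ []) (hub 2≤da ∷ hub 2≤db ∷ hub 2≤dc ∷ []))
  where
  balance : 1 + 2 * length S ≡ (2 * m + 1) + sum (surplus S)
  balance = trans (handshake-surplus-isolated {S = S} du≡0 covered) (cong (_+ sum (surplus S)) n≡2m+1)
  hub : ∀ {v} → 2 ≤ degree v S → 1 ≤ surplus S v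
  hub = ℕ.∸-monoˡ-≤ 1

single-hub-not-maximal : MaximalGP S → degree c S ≡ 2 → (∀ v → v ≢ c → degree v S ≡ 1) → ⊥
single-hub-not-maximal {S = S} {c = c} max dc≡2 others≡1
  with degree-≥1⇒edge {S = S} (subst (1 ≤_) (sym dc≡2) (s≤s z≤n))
... | x , x∈S , c∈x with degree-≥2⇒another-edge (proj₁ (proj₁ max)) (ℕ.≤-reflexive (sym dc≡2)) x
...   | z , z∈S , z≢x , c∈z with other-end c∈x | other-end c∈z
...     | a , a≢c , a∈x | b , b≢c , b∈z =
  cherry-extends max x∈S z∈S c∈x c∈z a∈x b∈z a≢c b≢c a≢b (leaf a≢c) (leaf b≢c) (ℕ.≤-reflexive (cong suc dc≡2))
  where
  a≢b : a ≢ b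
  a≢b refl = z≢x (edge-unique a≢c b∈z c∈z a∈x c∈x)
  leaf : ∀ {v} → v ≢ c → degree v S < 2
  leaf {v} v≢c = ℕ.≤-reflexive (cong suc (others≡1 v v≢c))

isolated⇒three-hubs : {S : List (LKVertex n)} → 2 ≤ n → MaximalGP S → degree u S ≡ 0 →
  ¬ ¬ (∃[ a ] ∃[ b ] ∃[ c ] (a ≢ b × a ≢ c × b ≢ c × 2 ≤ degree a S × 2 ≤ degree b S × 2 ≤ degree c S))
isolated⇒three-hubs {u = u} {S} 2≤n max du≡0 no-three-hubs =
  edge-to-hub max du≡0 (proj₂ (another-point 2≤n u)) λ (_ , c , _ , _ , _ , _ , 2≤dc) →
  edge-to-hub max du≡0 (hub≢u 2≤dc) λ (y , d , y∈S , c∈y , d∈y , d≢c , 2≤dd) →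
  let e , e≢c , e≢d , 2≤de = adjacent-hubs⇒third-hub (proj₁ (proj₁ max)) (generalPosition⇒P₃-free (proj₁ max))
                               y∈S c∈y d∈y (≢-sym d≢c) 2≤dc 2≤dd
  in no-three-hubs (c , d , e , ≢-sym d≢c , ≢-sym e≢c , ≢-sym e≢d , 2≤dc , 2≤dd , 2≤de)
  where
  hub≢u : ∀ {c} → 2 ≤ degree c S → c ≢ u
  hub≢u 2≤dc refl with subst (2 ≤_) du≡0 2≤dc
  ... | ()

n≤1+2*length : {S : List (LKVertex n)} → MaximalGP S → n ≤ suc (2 * length S)
n≤1+2*length {n = n} {S} max with F.any? (λ u → degree u S ℕ.≟ 0)
... | yes (u , du≡0) = begin
  n                       ≤⟨ ℕ.m≤m+n n _ ⟩
  n + sum (surplus S)     ≡⟨ handshake-surplus-isolated {S = S} du≡0 (λ v → covered-except-isolated max du≡0) ⟨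
  suc (2 * length S)      ∎
  where open ℕ.≤-Reasoning
... | no no-isolated = begin
  n                       ≤⟨ ℕ.m≤m+n n _ ⟩
  n + sum (surplus S)     ≡⟨ handshake-surplus {S = S} (λ v → ℕ.n≢0⇒n>0 λ dv≡0 → no-isolated (v , dv≡0)) ⟨
  2 * length S            ≤⟨ ℕ.n≤1+n _ ⟩
  suc (2 * length S)      ∎
  where open ℕ.≤-Reasoning

even-lower-bound : {S : List (LKVertex n)} → n ≡ 2 * m → MaximalGP S → m ≤ length S
even-lower-bound {n = n} {m = m} {S} n≡2m max = ℕ.≮⇒≥ λ l<m → ℕ.<⇒≱ (s≤s ℕ.≤-refl) (begin
  2 + 2 * length S  ≡⟨ ℕ.*-suc 2 (length S) ⟨
  2 * suc (length S) ≤⟨ ℕ.*-monoʳ-≤ 2 l<m ⟩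
  2 * m              ≡⟨ n≡2m ⟨
  n                  ≤⟨ n≤1+2*length max ⟩
  suc (2 * length S) ∎)
  where open ℕ.≤-Reasoning

odd-lower-bound : {S : List (LKVertex n)} → 2 ≤ n → n ≡ 2 * m + 1 → MaximalGP S → m + 2 ≤ length S
odd-lower-bound {n = n} {m} {S} 2≤n n≡2m+1 max =
  ℕ.≮⇒≥ λ l<m+2 → too-small (ℕ.≤-pred (subst (suc (length S) ≤_) (ℕ.+-comm m 2) l<m+2))
  where
  too-small : length S ≤ suc m → ⊥
  too-small l≤1+m with F.any? (λ u → degree u S ℕ.≟ 0)
  ... | yes (u , du≡0) = isolated⇒three-hubs 2≤n max du≡0 λ (a , b , c , a≢b , a≢c , b≢c , 2≤da , 2≤db , 2≤dc) →
    three-hubs-too-many {S = S} n≡2m+1 l≤1+m du≡0 (λ v → covered-except-isolated max du≡0) a≢b a≢c b≢c 2≤da 2≤db 2≤dc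
  ... | no no-isolated =
    let c , dc≡2 , others≡1 = single-hub {S = S} n≡2m+1 l≤1+m (λ v → ℕ.n≢0⇒n>0 λ dv≡0 → no-isolated (v , dv≡0))
    in single-hub-not-maximal max dc≡2 others≡1

-- Maximal sets from clusters

Separates : List (LKVertex n) → LKVertex n → Set
Separates S t = ∃[ x ] ∃[ z ] (x ∈ S × z ∈ S × ¬ Meets x z × Meets x t × Meets t z)

-- S consists of vertex-disjoint edges and triangles covering all points.
record SpanningClusters (S : List (LKVertex n)) : Set where
  field
    unique     : Unique S
    transitive : ∀ {x y z} → x ∈ S → y ∈ S → z ∈ S → Meets x y → Meets y z → Meets x z
    spanning   : ∀ w → ∃[ x ] (x ∈ S × w ∈ₑ x)
    saturated  : ∀ t → t ∉ S → Separates S t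

clusters⇒maximal : {S : List (LKVertex n)} → SpanningClusters S → MaximalGP S
clusters⇒maximal {S = S} clusters = maximal-if-outsiders-are-P₃-centres gpS centre
  where
  open SpanningClusters clusters
  gpS : GeneralPosition S
  gpS = P₃-free⇒generalPosition unique λ (_ , _ , _ , x∈S , y∈S , z∈S , P₃@(x-y , y-z , _)) →
    P₃-ends-disjoint P₃ (transitive x∈S y∈S z∈S (adj⇒meets x-y) (adj⇒meets y-z))
  centre : ∀ t → t ∉ S → ∃[ x ] ∃[ z ] (x ∈ S × z ∈ S × InducedP₃ x t z)
  centre t t∉S with saturated t t∉S
  ... | x , z , x∈S , z∈S , x≁z , x~t , t~z =
    x , z , x∈S , z∈S , induced-P₃ (λ { refl → t∉S x∈S }) (λ { refl → t∉S z∈S }) x~t t~z x≁z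

module Embedding (ρ : Fin k → Fin l) (ρ-mono : ∀ {i j} → i F.< j → ρ i F.< ρ j) where

  mapₑ : LKVertex k → LKVertex l
  mapₑ ((i , j) , i<j) = (ρ i , ρ j) , ρ-mono i<j

  ρ-reflects : ∀ {i j} → ρ i F.< ρ j → i F.< j
  ρ-reflects {i} {j} ρi<ρj with F.<-cmp i j
  ... | tri< i<j _ _ = i<j
  ... | tri≈ _ refl _ = contradiction ρi<ρj (ℕ.<-irrefl refl)
  ... | tri> _ _ j<i = contradiction ρi<ρj (ℕ.<-asym (ρ-mono j<i))

  ρ-injective : ∀ {i j} → ρ i ≡ ρ j → i ≡ j
  ρ-injective {i} {j} ρi≡ρj with F.<-cmp i j
  ... | tri< i<j _ _ = contradiction (cong F.toℕ ρi≡ρj) (ℕ.<⇒≢ (ρ-mono i<j))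
  ... | tri≈ _ i≡j _ = i≡j
  ... | tri> _ _ j<i = contradiction (cong F.toℕ ρi≡ρj) (ℕ.>⇒≢ (ρ-mono j<i))

  mapₑ-injective : ∀ {x y} → mapₑ x ≡ mapₑ y → x ≡ y
  mapₑ-injective {(i , j) , _} {(i′ , j′) , _} eq =
    edge-ext (ρ-injective (cong (λ e → proj₁ (proj₁ e)) eq)) (ρ-injective (cong (λ e → proj₂ (proj₁ e)) eq))

  ∈ₑ-mapₑ⁺ : ∀ {w x} → w ∈ₑ x → ρ w ∈ₑ mapₑ x
  ∈ₑ-mapₑ⁺ start = start
  ∈ₑ-mapₑ⁺ end   = end

  ∈ₑ-mapₑ⁻ : ∀ {w x} → w ∈ₑ mapₑ x → ∃[ v ] (ρ v ≡ w × v ∈ₑ x)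
  ∈ₑ-mapₑ⁻ {x = (i , j) , _} start = i , refl , start
  ∈ₑ-mapₑ⁻ {x = (i , j) , _} end   = j , refl , end

  meets-mapₑ⁺ : ∀ {x y} → Meets x y → Meets (mapₑ x) (mapₑ y)
  meets-mapₑ⁺ (w , w∈x , w∈y) = ρ w , ∈ₑ-mapₑ⁺ w∈x , ∈ₑ-mapₑ⁺ w∈y

  meets-mapₑ⁻ : ∀ {x y} → Meets (mapₑ x) (mapₑ y) → Meets x y
  meets-mapₑ⁻ (w , w∈x , w∈y) with ∈ₑ-mapₑ⁻ w∈x | ∈ₑ-mapₑ⁻ w∈y
  ... | v , refl , v∈x | v′ , ρv′≡ρv , v′∈y = v , v∈x , subst (_∈ₑ _) (ρ-injective ρv′≡ρv) v′∈y

  mapₑ-image : ∀ {i j} {i<j : ρ i F.< ρ j} → ∃[ t ] (mapₑ t ≡ ((ρ i , ρ j) , i<j))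
  mapₑ-image {i} {j} {ρi<ρj} = ((i , j) , ρ-reflects ρi<ρj) , edge-ext refl refl

  separates-mapₑ : ∀ {S U t} → (∀ {x} → x ∈ S → mapₑ x ∈ U) → Separates S t → Separates U (mapₑ t)
  separates-mapₑ S⊆U (x , z , x∈S , z∈S , x≁z , x~t , t~z) =
    mapₑ x , mapₑ z , S⊆U x∈S , S⊆U z∈S , x≁z ∘ meets-mapₑ⁻ , meets-mapₑ⁺ x~t , meets-mapₑ⁺ t~z

↑ˡ-mono : ∀ {i j : Fin k} → i F.< j → i ↑ˡ l F.< j ↑ˡ l
↑ˡ-mono {l = l} {i} {j} i<j = subst₂ _<_ (sym (F.toℕ-↑ˡ i l)) (sym (F.toℕ-↑ˡ j l)) i<j

↑ʳ-mono : ∀ {i j : Fin l} → i F.< j → k ↑ʳ i F.< k ↑ʳ j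
↑ʳ-mono {k = k} {i = i} {j} i<j = subst₂ _<_ (sym (F.toℕ-↑ʳ k i)) (sym (F.toℕ-↑ʳ k j)) (ℕ.+-monoʳ-< k i<j)

↑ˡ≢↑ʳ : (i : Fin k) (j : Fin l) → i ↑ˡ l ≢ k ↑ʳ j
↑ˡ≢↑ʳ {k} {l} i j eq = ℕ.<⇒≱ (F.toℕ<n i) (begin
  k               ≤⟨ ℕ.m≤m+n k (F.toℕ j) ⟩
  k + F.toℕ j     ≡⟨ F.toℕ-↑ʳ k j ⟨
  F.toℕ (k ↑ʳ j)  ≡⟨ cong F.toℕ eq ⟨
  F.toℕ (i ↑ˡ l)  ≡⟨ F.toℕ-↑ˡ i l ⟩
  F.toℕ i         ∎)
  where open ℕ.≤-Reasoning

module Left {k l : ℕ} = Embedding {k} {k + l} (_↑ˡ l) ↑ˡ-mono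
module Right {k l : ℕ} = Embedding {l} {k + l} (k ↑ʳ_) ↑ʳ-mono

_⊎ₑ_ : List (LKVertex k) → List (LKVertex l) → List (LKVertex (k + l))
_⊎ₑ_ {k} {l} S T = map (Left.mapₑ {k} {l}) S ++ map (Right.mapₑ {k} {l}) T

length-⊎ₑ : (S : List (LKVertex k)) (T : List (LKVertex l)) → length (S ⊎ₑ T) ≡ length S + length T
length-⊎ₑ S T = trans (List.length-++ (map _ S)) (cong₂ _+_ (List.length-map _ S) (List.length-map _ T))

left-right-disjoint : ∀ {x : LKVertex k} {y : LKVertex l} → ¬ Meets (Left.mapₑ {k} {l} x) (Right.mapₑ {k} {l} y)
left-right-disjoint {k} {l} (w , w∈x , w∈y) with Left.∈ₑ-mapₑ⁻ {k} {l} w∈x | Right.∈ₑ-mapₑ⁻ {k} {l} w∈y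
... | i , refl , _ | j , ρj≡w , _ = ↑ˡ≢↑ʳ i j (sym ρj≡w)

split-point : (w : Fin (k + l)) → (∃[ i ] i ↑ˡ l ≡ w) ⊎ (∃[ j ] k ↑ʳ j ≡ w)
split-point {k} w with F.splitAt k w in eq
... | inj₁ i = inj₁ (i , F.splitAt⁻¹-↑ˡ eq)
... | inj₂ j = inj₂ (j , F.splitAt⁻¹-↑ʳ eq)

_⊕_ : {S : List (LKVertex k)} {T : List (LKVertex l)} →
      SpanningClusters S → SpanningClusters T → SpanningClusters (S ⊎ₑ T)
_⊕_ {k} {l} {S} {T} CS CT = record
  { unique     = Unique.++⁺ (Unique.map⁺ Left.mapₑ-injective CS.unique)
                            (Unique.map⁺ Right.mapₑ-injective CT.unique) sides-disjoint
  ; transitive = transitive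
  ; spanning   = spanning
  ; saturated  = saturated
  }
  where
  module CS = SpanningClusters CS
  module CT = SpanningClusters CT
  leftₑ : LKVertex k → LKVertex (k + l)
  leftₑ = Left.mapₑ
  rightₑ : LKVertex l → LKVertex (k + l)
  rightₑ = Right.mapₑ

  left∈ : ∀ {x} → x ∈ S → leftₑ x ∈ S ⊎ₑ T
  left∈ x∈S = ∈-++⁺ˡ (∈-map⁺ leftₑ x∈S)
  right∈ : ∀ {x} → x ∈ T → rightₑ x ∈ S ⊎ₑ T
  right∈ x∈T = ∈-++⁺ʳ (map leftₑ S) (∈-map⁺ rightₑ x∈T)

  side : ∀ {x} → x ∈ S ⊎ₑ T → (∃[ x′ ] (x′ ∈ S × x ≡ leftₑ x′)) ⊎ (∃[ x′ ] (x′ ∈ T × x ≡ rightₑ x′))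
  side x∈ with ∈-++⁻ (map leftₑ S) x∈
  ... | inj₁ x∈L = inj₁ (∈-map⁻ leftₑ x∈L)
  ... | inj₂ x∈R = inj₂ (∈-map⁻ rightₑ x∈R)

  sides-disjoint : ∀ {v} → ¬ (v ∈ map leftₑ S × v ∈ map rightₑ T)
  sides-disjoint (v∈L , v∈R) with ∈-map⁻ leftₑ v∈L | ∈-map⁻ rightₑ v∈R
  ... | x , _ , refl | y , _ , x≡y = left-right-disjoint (subst (Meets (leftₑ x)) x≡y (meets-refl _))

  transitive : ∀ {x y z} → x ∈ S ⊎ₑ T → y ∈ S ⊎ₑ T → z ∈ S ⊎ₑ T → Meets x y → Meets y z → Meets x z
  transitive x∈ y∈ z∈ x~y y~z with side x∈ | side y∈ | side z∈
  ... | inj₁ (_ , x∈S , refl) | inj₁ (_ , y∈S , refl) | inj₁ (_ , z∈S , refl) =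
    Left.meets-mapₑ⁺ (CS.transitive x∈S y∈S z∈S (Left.meets-mapₑ⁻ x~y) (Left.meets-mapₑ⁻ y~z))
  ... | inj₂ (_ , x∈T , refl) | inj₂ (_ , y∈T , refl) | inj₂ (_ , z∈T , refl) =
    Right.meets-mapₑ⁺ (CT.transitive x∈T y∈T z∈T (Right.meets-mapₑ⁻ x~y) (Right.meets-mapₑ⁻ y~z))
  ... | inj₁ (_ , _ , refl) | inj₂ (_ , _ , refl) | _ = ⊥-elim (left-right-disjoint x~y)
  ... | inj₂ (_ , _ , refl) | inj₁ (_ , _ , refl) | _ = ⊥-elim (left-right-disjoint (meets-sym x~y))
  ... | inj₁ _ | inj₁ (_ , _ , refl) | inj₂ (_ , _ , refl) = ⊥-elim (left-right-disjoint y~z)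
  ... | inj₂ _ | inj₂ (_ , _ , refl) | inj₁ (_ , _ , refl) = ⊥-elim (left-right-disjoint (meets-sym y~z))

  spanning : ∀ w → ∃[ x ] (x ∈ S ⊎ₑ T × w ∈ₑ x)
  spanning w with split-point {k} {l} w
  ... | inj₁ (i , refl) = let x , x∈S , i∈x = CS.spanning i in leftₑ x , left∈ x∈S , Left.∈ₑ-mapₑ⁺ i∈x
  ... | inj₂ (j , refl) = let x , x∈T , j∈x = CT.spanning j in rightₑ x , right∈ x∈T , Right.∈ₑ-mapₑ⁺ j∈x

  straddling : ∀ {t i j} → (i ↑ˡ l) ∈ₑ t → (k ↑ʳ j) ∈ₑ t → Separates (S ⊎ₑ T) t
  straddling {i = i} {j} i∈t j∈t =
    let x , x∈S , i∈x = CS.spanning i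
        z , z∈T , j∈z = CT.spanning j
    in leftₑ x , rightₑ z , left∈ x∈S , right∈ z∈T , left-right-disjoint ,
       (_ , Left.∈ₑ-mapₑ⁺ i∈x , i∈t) , (_ , j∈t , Right.∈ₑ-mapₑ⁺ j∈z)

  saturated : ∀ t → t ∉ S ⊎ₑ T → Separates (S ⊎ₑ T) t
  saturated ((p , q) , _) t∉ with split-point {k} {l} p | split-point {k} {l} q
  ... | inj₁ (i , refl) | inj₂ (j , refl) = straddling start end
  ... | inj₂ (j , refl) | inj₁ (i , refl) = straddling end start
  ... | inj₁ (i , refl) | inj₁ (j , refl) =
    let t′ , t′↦t = Left.mapₑ-image
    in subst (Separates _) t′↦t
         (Left.separates-mapₑ left∈ (CS.saturated t′ λ t′∈S → t∉ (subst (_∈ _) t′↦t (left∈ t′∈S))))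
  ... | inj₂ (i , refl) | inj₂ (j , refl) =
    let t′ , t′↦t = Right.mapₑ-image
    in subst (Separates _) t′↦t
         (Right.separates-mapₑ right∈ (CT.saturated t′ λ t′∈T → t∉ (subst (_∈ _) t′↦t (right∈ t′∈T))))

complete-clusters : {S : List (LKVertex n)} → Unique S → (∀ t → t ∈ S) → (∀ {x y} → x ∈ S → y ∈ S → Meets x y) →
                    (∀ w → ∃[ x ] (x ∈ S × w ∈ₑ x)) → SpanningClusters S
complete-clusters unique every-edge edges-meet spanning = record
  { unique     = unique
  ; transitive = λ x∈S _ z∈S _ _ → edges-meet x∈S z∈S
  ; spanning   = spanning
  ; saturated  = λ t t∉S → contradiction (every-edge t) t∉S
  }

K₂ : List (LKVertex 2)
K₂ = ((zero , suc zero) , s≤s z≤n) ∷ []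

K₂-clusters : SpanningClusters K₂
K₂-clusters = complete-clusters ([] ∷ []) every-edge (λ { (here refl) (here refl) → meets-refl _ }) spanning
  where
  every-edge : ∀ t → t ∈ K₂
  every-edge ((zero , suc zero) , s≤s z≤n) = here refl
  spanning : ∀ w → ∃[ x ] (x ∈ K₂ × w ∈ₑ x)
  spanning zero       = _ , here refl , start
  spanning (suc zero) = _ , here refl , end

K₃ : List (LKVertex 3)
K₃ = ((zero , suc zero) , s≤s z≤n) ∷ ((zero , suc (suc zero)) , s≤s z≤n) ∷ ((suc zero , suc (suc zero)) , s≤s (s≤s z≤n)) ∷ []

K₃-clusters : SpanningClusters K₃
K₃-clusters = complete-clusters ((( λ ()) ∷ (λ ()) ∷ []) ∷ ((λ ()) ∷ []) ∷ [] ∷ []) every-edge edges-meet spanning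
  where
  every-edge : ∀ t → t ∈ K₃
  every-edge ((zero , suc zero) , s≤s z≤n) = here refl
  every-edge ((zero , suc (suc zero)) , s≤s z≤n) = there (here refl)
  every-edge ((suc zero , suc (suc zero)) , s≤s (s≤s z≤n)) = there (there (here refl))
  edges-meet : ∀ {x y} → x ∈ K₃ → y ∈ K₃ → Meets x y
  edges-meet (here refl) (here refl) = _ , start , start
  edges-meet (here refl) (there (here refl)) = _ , start , start
  edges-meet (here refl) (there (there (here refl))) = _ , end , start
  edges-meet (there (here refl)) (here refl) = _ , start , start
  edges-meet (there (here refl)) (there (here refl)) = _ , start , start
  edges-meet (there (here refl)) (there (there (here refl))) = _ , end , end
  edges-meet (there (there (here refl))) (here refl) = _ , start , end
  edges-meet (there (there (here refl))) (there (here refl)) = _ , end , end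
  edges-meet (there (there (here refl))) (there (there (here refl))) = _ , start , start
  spanning : ∀ w → ∃[ x ] (x ∈ K₃ × w ∈ₑ x)
  spanning zero             = _ , here refl , start
  spanning (suc zero)       = _ , here refl , end
  spanning (suc (suc zero)) = _ , there (here refl) , end

empty-clusters : SpanningClusters {0} []
empty-clusters = complete-clusters [] (λ { ((() , _) , _) }) (λ ()) (λ ())

perfect-matching : ∀ m → List (LKVertex (m * 2))
perfect-matching zero    = []
perfect-matching (suc m) = K₂ ⊎ₑ perfect-matching m

perfect-matching-clusters : ∀ m → SpanningClusters (perfect-matching m)
perfect-matching-clusters zero    = empty-clusters
perfect-matching-clusters (suc m) = K₂-clusters ⊕ perfect-matching-clusters m

length-perfect-matching : ∀ m → length (perfect-matching m) ≡ m
length-perfect-matching zero    = refl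
length-perfect-matching (suc m) = trans (length-⊎ₑ K₂ (perfect-matching m)) (cong suc (length-perfect-matching m))

even-witness : n ≡ 2 * m → ∃[ S ] (MaximalGP {n} S × length S ≡ m)
even-witness {m = m} n≡2m with trans n≡2m (ℕ.*-comm 2 m)
... | refl =
  perfect-matching m , clusters⇒maximal (perfect-matching-clusters m) , length-perfect-matching m

odd-order : ∀ m → 2 * suc m + 1 ≡ 3 + m * 2
odd-order = solve-∀

odd-witness : n ≡ 2 * suc m + 1 → ∃[ S ] (MaximalGP {n} S × length S ≡ suc m + 2)
odd-witness {m = m} n≡2m+3 with trans n≡2m+3 (odd-order m)
... | refl =
  K₃ ⊎ₑ perfect-matching m , clusters⇒maximal (K₃-clusters ⊕ perfect-matching-clusters m) , (begin
    length (K₃ ⊎ₑ perfect-matching m)   ≡⟨ length-⊎ₑ K₃ (perfect-matching m) ⟩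
    3 + length (perfect-matching m)     ≡⟨ cong (3 +_) (length-perfect-matching m) ⟩
    3 + m                               ≡⟨ cong suc (ℕ.+-comm 2 m) ⟩
    suc m + 2                           ∎)
  where open ≡-Reasoning

theorem5p2 : ∀ (n m : ℕ) → 2 ≤ n →
    (n ≡ 2 * m → gpMinusLKIs n m) × (n ≡ 2 * m + 1 → gpMinusLKIs n (m + 2))
theorem5p2 n m 2≤n = (λ n≡2m → even-witness n≡2m , λ _ → even-lower-bound n≡2m) , odd m
  where
  odd : ∀ m → n ≡ 2 * m + 1 → gpMinusLKIs n (m + 2)
  odd zero    n≡1    = contradiction (subst (2 ≤_) n≡1 2≤n) λ { (s≤s ()) }
  odd (suc m) n≡2m+3 = odd-witness n≡2m+3 , λ _ → odd-lower-bound {m = suc m} 2≤n n≡2m+3
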